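{- Let $k\in\{1,2\}$. 1. (Extension Lemma) If $I\subseteq Form$ is nonempty and closed under disjunction and $Th_{\vdash_k}(\Gamma)\cap I=\emptyset$, then there is $\langle\Phi,I^\bot_k(\Phi)\rangle\in W^b_k$ with $\Gamma\subseteq\Phi$ and $\Phi\cap I=\emptyset$. 2. (Implication Lemma) If $\Gamma\nvdash_k\alpha\to\beta$, then there is $\langle\Phi,I^\bot_k(\Phi)\rangle\in W^b_k$ with $\Gamma\cap I^\bot_k(\Phi)=\emptyset$, $\alpha\in\Phi$ and $\beta\notin\Phi$. 3. (Fixpoint Lemma) If $\Gamma\nvdash_k\gamma$, then there is $\langle\Phi,I^\gamma_k(\Phi)\rangle\in W^b_k$ with $\Gamma\cap I^\gamma_k(\Phi)=\emptyset$. 4. (Pseudo-reflexivity Lemma) For every $\langle\Gamma,\Delta\rangle\in W^d_1$ with $\bot\notin\Gamma$, there is $\langle\Phi,I^\bot_1(\Phi)\rangle\in W^b_1$ with $\Gamma\subseteq\Phi$ and $\Gamma\cap I^\bot_1(\Phi)=\emptyset$. 5. (Pseudo-symmetry Lemma) For all $\langle\Gamma,\Delta\rangle,\langle\Gamma',\Delta'\rangle\in W^d_k$ with $\Gamma\cap\Delta'=\emptyset$, there is $\langle\Phi,I^\bot_k(\Phi)\rangle\in W^b_k$ with $\Gamma\subseteq\Phi$ and $\Gamma'\cap I^\bot_k(\Phi)=\emptyset$.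
   Context: Formulas are built from a countable set $PL$ of propositional letters and the constant $\bot$ using binary connectives $\land,\lor,\to$; $Form$ is the set of formulas; $\neg\alpha:=\alpha\to\bot$, $\top:=\bot\to\bot$; precedence $\neg>\land=\lor>\to$. Any $\vdash\subseteq Form\times Form$ is extended to sets: $\Gamma\vdash\alpha$ iff $\bigwedge\Gamma_0\vdash\alpha$ for some finite $\Gamma_0\subseteq\Gamma$ ($\bigwedge\emptyset=\top$); "$\vdash\alpha$" means $\chi\vdash\alpha$ for all $\chi$. Basic rules (all formulas, all $n\ge1$): (A) $\alpha\vdash\alpha$; (Cut) $\alpha\vdash\beta,\beta\vdash\gamma\Rightarrow\alpha\vdash\gamma$; ($\bot$) $\bot\vdash\alpha$; ($\land$R) $\chi\vdash\alpha,\chi\vdash\beta\Rightarrow\chi\vdash\alpha\land\beta$; ($\land$L) $\alpha\land\beta\vdash\alpha$, $\alpha\land\beta\vdash\beta$; ($\lor$R) $\alpha\vdash\alpha\lor\beta$, $\beta\vdash\alpha\lor\beta$; ($\lor$L) $\alpha\vdash\chi,\beta\vdash\chi\Rightarrow\alpha\lor\beta\vdash\chi$; (DT$_0$) $\alpha\vdash\beta\Rightarrow\ \vdash\alpha\to\beta$; ($\to\land$) $(\alpha\to\beta)\land(\alpha\to\gamma)\vdash\alpha\to\beta\land\gamma$; ($\to$tr) $(\alpha\to\beta)\land(\beta\to\gamma)\vdash\alpha\to\gamma$; ($\to$-$\lor$.s) $\bigvee_{j\le n}(\alpha_j\to\beta_j)\land\bigwedge_j(\psi_j\land\beta_j\to\chi)\vdash\bigwedge_j(\psi_j\land\alpha_j)\to\chi$.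 Further: (Abs) $\alpha\land\neg\alpha\vdash\bot$; ($\neg\neg$I) $\alpha\vdash\neg\neg\alpha$; (Refl$_1$) if $\psi_j\land\beta_j\vdash\chi$ for all $j\le n$ then $\bigwedge_j(\psi_j\land\alpha_j)\land\bigvee_j(\alpha_j\to\beta_j)\vdash\chi$; (Refl$_2$) $\bigwedge_{j\le n}(\psi_j\land\beta_j\to\chi)\vdash\bigwedge_j(\psi_j\land\alpha_j)\land\bigvee_j(\alpha_j\to\beta_j)\to\chi$. i-formulas: $\Delta\sqsupset\Theta$ with $\Delta,\Theta$ nonempty finite subsets of $Form$. $\Vdash_1$ is the least relation between sets of i-formulas and i-formulas satisfying: (A) $\Gamma^i\cup\{\alpha^i\}\Vdash\alpha^i$; (Cut) $\Gamma^i\Vdash\alpha^i,\ \Phi^i\cup\{\alpha^i\}\Vdash\beta^i\Rightarrow\Gamma^i\cup\Phi^i\Vdash\beta^i$; (i-A) $\Delta\cap\Theta\ne\emptyset\Rightarrow\emptyset\Vdash\Delta\sqsupset\Theta$; (i-Cut) $\{\Delta_1\sqsupset\Theta_1\cup\{\varphi\},\Delta_2\cup\{\varphi\}\sqsupset\Theta_2\}\Vdash\Delta_1\cup\Delta_2\sqsupset\Theta_1\cup\Theta_2$; (i-$\land$L) $\emptyset\Vdash\{\varphi\land\psi\}\sqsupset\{\varphi\}$, $\emptyset\Vdash\{\varphi\land\psi\}\sqsupset\{\psi\}$; (i-$\land$R) $\emptyset\Vdash\{\varphi,\psi\}\sqsupset\{\varphi\land\psi\}$. $\Vdash_2^\gamma$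 additionally satisfies ($\gamma$-Refl) $\emptyset\Vdash\{\varphi_1,\dots,\varphi_n,\bigvee_j(\varphi_j\to\psi_j)\lor\gamma\}\sqsupset\{\psi_1,\dots,\psi_n\}$. $i_\gamma(\Gamma)=\{\{\varphi_1..\varphi_n\}\sqsupset\{\psi_1..\psi_n\}\mid n\ge1,\bigvee_j(\varphi_j\to\psi_j)\lor\gamma\in\Gamma\}$; $Th_\vdash(\Gamma)=\{\alpha\mid\Gamma\vdash\alpha\}$. (Prop$_1$): if $i_\gamma(Th_\vdash(\alpha))\Vdash_1\{\top\}\sqsupset\{\bot\}$ then $\alpha\vdash\gamma$; (Prop$_2$): same with $\Vdash_2^\gamma$. $\vdash_1$ is the smallest relation satisfying the basic rules, (Abs), ($\neg\neg$I), (Prop$_1$); $\vdash_2$ the smallest satisfying the basic rules, ($\neg\neg$I), (Refl$_1$), (Refl$_2$), (Prop$_2$). Canonical sets. $\Gamma$ is $\vdash$-closed iff $Th_\vdash(\Gamma)\subseteq\Gamma$; $\Delta$ is $\vdash$-downward closed iff $\beta\in\Delta$ and $\alpha\vdash\beta$ imply $\alpha\in\Delta$; $\neg(\Gamma)=\{\neg\alpha\mid\alpha\in\Gamma\}$; $\to\!(\Gamma)=\{\alpha\to\beta\mid\alpha\in\Gamma,\beta\notin\Gamma\}$; a set is closed under disjunction if $\alpha,\beta$ in it imply $\alpha\lor\beta$ in it. $W^d_1$ is the set of pairs $\langle\Gamma,\Delta\rangle$ of sets of formulas with $\Gamma$ $\vdash_1$-closed, $\{\bot\}\cup\neg(\Gamma)\cup\to\!(\Gamma)\subseteq\Delta$,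 and $\Delta$ $\vdash_1$-downward closed and closed under disjunction; $W^d_2$ is defined likewise with $\vdash_2$ plus $\Gamma\cap\Delta=\emptyset$. $I^\gamma_k(\Gamma)=\{\varphi\mid\exists n\ge1,\ \alpha_1,\dots,\alpha_n\in\Gamma,\ \beta_1,\dots,\beta_n\notin\Gamma$ with $\varphi\vdash_k(\alpha_1\to\beta_1)\lor\dots\lor(\alpha_n\to\beta_n)\lor\gamma\}$. $W^b_1=\{\langle\Gamma,I^\gamma_1(\Gamma)\rangle\mid\gamma\in Form,\ \Gamma\ \vdash_1\text{ -closed},\ \bot\notin\Gamma\}$; $W^b_2=\{\langle\Gamma,I^\gamma_2(\Gamma)\rangle\mid\gamma\in Form,\ \Gamma\ \vdash_2\text{ -closed},\ \bot\notin\Gamma,\ \Gamma\cap I^\gamma_2(\Gamma)=\emptyset\}$. -}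

module Defs where

open import Data.Nat using (ℕ)
open import Data.List using (List; []; _∷_)
open import Data.List.NonEmpty using (List⁺; _∷_; _∷⁺_; _⁺++⁺_; toList; foldr₁) renaming (map to map⁺; [_] to [_]⁺)
open import Data.List.Membership.Propositional using (_∈_)
open import Data.Product using (Σ; ∃; _×_; _,_; proj₁; proj₂)
open import Data.Sum using (_⊎_)
open import Data.Maybe using (Maybe; just; nothing)
open import Data.Empty using (⊥)
open import Relation.Nullary using (¬_)
open import Relation.Binary.PropositionalEquality using (_≡_)
open import Function.Bundles using (_⇔_)

infixr 30 _∧ᶠ_ _∨ᶠ_
infixr 20 _⇒_

data Form : Set where
  var   : ℕ → Form
  bot   : Form
  _∧ᶠ_  : Form → Form → Form
  _∨ᶠ_  : Form → Form → Form
  _⇒_   : Form → Form → Form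

neg : Form → Form
neg α = α ⇒ bot

top : Form
top = bot ⇒ bot

⋁ : List⁺ Form → Form
⋁ = foldr₁ _∨ᶠ_

⋀ : List⁺ Form → Form
⋀ = foldr₁ _∧ᶠ_

⋀L : List Form → Form
⋀L []           = top
⋀L (a ∷ [])     = a
⋀L (a ∷ b ∷ l)  = a ∧ᶠ ⋀L (b ∷ l)

FSet : Set₁
FSet = Form → Set

-- i-formulas  Δ ⊐ Θ  (Δ, Θ nonempty finite sets, represented by nonempty
-- lists; lists with the same members denote the same i-formula)

record IForm : Set where
  constructor _⊐_
  field
    lhs : List⁺ Form
    rhs : List⁺ Form

_≈ᵢ_ : IForm → IForm → Set
(Δ ⊐ Θ) ≈ᵢ (Δ' ⊐ Θ') =
  (∀ x → (x ∈ toList Δ) ⇔ (x ∈ toList Δ')) × (∀ x → (x ∈ toList Θ) ⇔ (x ∈ toList Θ'))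

⋁→ : List⁺ (Form × Form) → Form
⋁→ ps = ⋁ (map⁺ (λ p → proj₁ p ⇒ proj₂ p) ps)

iSet : Form → FSet → IForm → Set
iSet γ Γ F = Σ (List⁺ (Form × Form)) λ ps →
  Γ (⋁→ ps ∨ᶠ γ) × (F ≡ (map⁺ proj₁ ps ⊐ map⁺ proj₂ ps))

-- Derivability of i-formulas from a set of i-formulas.
-- The mode is 'nothing' for ⊩₁ and 'just γ' for ⊩₂^γ.
-- (A) is 'hyp'; (Cut) is built into the hypothetical derivation format.
data Der (m : Maybe Form) (Γ : IForm → Set) : IForm → Set where
  hyp   : ∀ {F} → Γ F → Der m Γ F
  iEq   : ∀ {F F'} → Der m Γ F → F ≈ᵢ F' → Der m Γ F'
  iA    : ∀ {Δ Θ x} → x ∈ toList Δ → x ∈ toList Θ → Der m Γ (Δ ⊐ Θ)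
  iCut  : ∀ {Δ₁ Θ₁ Δ₂ Θ₂ φ} →
          Der m Γ (Δ₁ ⊐ (φ ∷⁺ Θ₁)) → Der m Γ ((φ ∷⁺ Δ₂) ⊐ Θ₂) →
          Der m Γ ((Δ₁ ⁺++⁺ Δ₂) ⊐ (Θ₁ ⁺++⁺ Θ₂))
  iAndL₁ : ∀ {φ ψ} → Der m Γ ([ φ ∧ᶠ ψ ]⁺ ⊐ [ φ ]⁺)
  iAndL₂ : ∀ {φ ψ} → Der m Γ ([ φ ∧ᶠ ψ ]⁺ ⊐ [ ψ ]⁺)
  iAndR  : ∀ {φ ψ} → Der m Γ ((φ ∷ ψ ∷ []) ⊐ [ φ ∧ᶠ ψ ]⁺)
  γRefl  : ∀ {γ} → m ≡ just γ → (ps : List⁺ (Form × Form)) →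
           Der m Γ (((⋁→ ps ∨ᶠ γ) ∷⁺ map⁺ proj₁ ps) ⊐ map⁺ proj₂ ps)

data K : Set where
  one two : K

mode : K → Form → Maybe Form
mode one γ = nothing
mode two γ = just γ

T3 : Set
T3 = Form × Form × Form

ta tb tψ : T3 → Form
ta (a , b , ψ) = a
tb (a , b , ψ) = b
tψ (a , b , ψ) = ψ

orImp : List⁺ T3 → Form
orImp ts = ⋁ (map⁺ (λ t → ta t ⇒ tb t) ts)

andImp : List⁺ T3 → Form → Form
andImp ts χ = ⋀ (map⁺ (λ t → (tψ t ∧ᶠ tb t) ⇒ χ) ts)

andPA : List⁺ T3 → Form
andPA ts = ⋀ (map⁺ (λ t → tψ t ∧ᶠ ta t) ts)

infix 10 _⊢⟨_⟩_

data _⊢⟨_⟩_ : Form → K → Form → Set where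
  ax    : ∀ {k α} → α ⊢⟨ k ⟩ α
  cut   : ∀ {k α β γ} → α ⊢⟨ k ⟩ β → β ⊢⟨ k ⟩ γ → α ⊢⟨ k ⟩ γ
  botL  : ∀ {k α} → bot ⊢⟨ k ⟩ α
  andR  : ∀ {k χ α β} → χ ⊢⟨ k ⟩ α → χ ⊢⟨ k ⟩ β → χ ⊢⟨ k ⟩ α ∧ᶠ β
  andL₁ : ∀ {k α β} → α ∧ᶠ β ⊢⟨ k ⟩ α
  andL₂ : ∀ {k α β} → α ∧ᶠ β ⊢⟨ k ⟩ β
  orR₁  : ∀ {k α β} → α ⊢⟨ k ⟩ α ∨ᶠ β
  orR₂  : ∀ {k α β} → β ⊢⟨ k ⟩ α ∨ᶠ β
  orL   : ∀ {k α β χ} → α ⊢⟨ k ⟩ χ → β ⊢⟨ k ⟩ χ → α ∨ᶠ β ⊢⟨ k ⟩ χ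
  dt₀   : ∀ {k α β} χ → α ⊢⟨ k ⟩ β → χ ⊢⟨ k ⟩ α ⇒ β
  impAnd : ∀ {k α β γ} → (α ⇒ β) ∧ᶠ (α ⇒ γ) ⊢⟨ k ⟩ α ⇒ β ∧ᶠ γ
  impTr  : ∀ {k α β γ} → (α ⇒ β) ∧ᶠ (β ⇒ γ) ⊢⟨ k ⟩ α ⇒ γ
  impOrS : ∀ {k} (ts : List⁺ T3) χ → orImp ts ∧ᶠ andImp ts χ ⊢⟨ k ⟩ andPA ts ⇒ χ
  absurd : ∀ {k α} → k ≡ one → α ∧ᶠ neg α ⊢⟨ k ⟩ bot
  nnI    : ∀ {k α} → α ⊢⟨ k ⟩ neg (neg α)
  refl₁  : ∀ {k} (ts : List⁺ T3) χ → k ≡ two →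
           (∀ t → t ∈ toList ts → tψ t ∧ᶠ tb t ⊢⟨ k ⟩ χ) →
           andPA ts ∧ᶠ orImp ts ⊢⟨ k ⟩ χ
  refl₂  : ∀ {k} (ts : List⁺ T3) χ → k ≡ two →
           andImp ts χ ⊢⟨ k ⟩ (andPA ts ∧ᶠ orImp ts) ⇒ χ
  prop   : ∀ {k α γ} →
           Der (mode k γ) (iSet γ (λ δ → α ⊢⟨ k ⟩ δ)) ([ top ]⁺ ⊐ [ bot ]⁺) →
           α ⊢⟨ k ⟩ γ

_⊢ₛ⟨_⟩_ : FSet → K → Form → Set
Γ ⊢ₛ⟨ k ⟩ α = Σ (List Form) λ Γ₀ → (∀ x → x ∈ Γ₀ → Γ x) × (⋀L Γ₀ ⊢⟨ k ⟩ α)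

_⊆_ : FSet → FSet → Set
Γ ⊆ Δ = ∀ x → Γ x → Δ x

Disjoint : FSet → FSet → Set
Disjoint Γ Δ = ∀ x → Γ x → Δ x → ⊥

_≐_ : FSet → FSet → Set
Γ ≐ Δ = ∀ x → Γ x ⇔ Δ x

Closed : K → FSet → Set
Closed k Γ = ∀ α → Γ ⊢ₛ⟨ k ⟩ α → Γ α

DownClosed : K → FSet → Set
DownClosed k Δ = ∀ α β → Δ β → α ⊢⟨ k ⟩ β → Δ α

OrClosed : FSet → Set
OrClosed Δ = ∀ α β → Δ α → Δ β → Δ (α ∨ᶠ β)

Iset : K → Form → FSet → FSet
Iset k γ Γ φ = Σ (List⁺ (Form × Form)) λ ps →
  (∀ p → p ∈ toList ps → Γ (proj₁ p) × ¬ Γ (proj₂ p)) × (φ ⊢⟨ k ⟩ ⋁→ ps ∨ᶠ γ)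

DisjIf : K → FSet → FSet → Set
DisjIf one Γ Δ = Data.Unit.⊤ where import Data.Unit
DisjIf two Γ Δ = Disjoint Γ Δ

Wd : K → FSet → FSet → Set
Wd k Γ Δ =
  Closed k Γ × Δ bot × (∀ α → Γ α → Δ (neg α)) ×
  (∀ α β → Γ α → ¬ Γ β → Δ (α ⇒ β)) ×
  DownClosed k Δ × OrClosed Δ × DisjIf k Γ Δ

Wb : K → FSet → FSet → Set
Wb k Γ Δ = Σ Form λ γ →
  Closed k Γ × ¬ Γ bot × DisjIf k Γ (Iset k γ Γ) × (Δ ≐ Iset k γ Γ)

{-# OPTIONS --safe #-}
module Submission where

-- Every part is a Lindenbaum construction. Take a property Bad of finite lists of formulas that
-- is monotone and survives replacing a formula by a list entailing it; run through an enumeration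
-- of all formulas and add each one unless the result gets a bad finite subset. The union Φ of the
-- stages is ⊢-closed, has no bad finite subset, and is maximal: each φ ∉ Φ has a bad list φ ∷ l
-- with l ⊆ Φ. The Extension lemma uses "⋀l entails a member of I", the Implication and the
-- pseudo-reflexivity/symmetry lemmas use "Γ ⊢ ⋀l → β", the Fixpoint lemma uses
-- "i_γ(Th Γ) ⊩ {⊤} ∪ l ⊐ {⊥}".
-- Disjointness from I^γ_k(Φ): if φ ⊢ ⋁(α_j → β_j) ∨ γ with all α_j ∈ Φ and β_j ∉ Φ, maximality
-- gives one finite M ⊆ Φ with every β_j ∷ M bad. These bad lists are merged with the α_j into a
-- bad finite subset of Φ: by (→-∨.s) when φ ∈ Γ and by (Refl₁)/(Refl₂) when φ ∈ Φ, k = 2; in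
-- the Fixpoint case by i-Cut against the i-formula that φ (hypothesis) or (γ-Refl) provides.

open import Defs
open import Data.Empty using (⊥; ⊥-elim)
open import Data.List using (List; []; _∷_; _++_)
open import Data.List.Properties using (map-∘)
open import Data.List.NonEmpty using (List⁺; _∷_; _∷⁺_; _⁺++⁺_; toList)
  renaming (map to map⁺; [_] to [_]⁺)
open import Data.List.Membership.Propositional using (_∈_)
open import Data.List.Membership.Propositional.Properties using (∈-++⁻; ∈-map⁺)
open import Data.List.Relation.Unary.Any using (here; there)
open import Data.List.Relation.Unary.All as All using (All; []; _∷_)
import Data.List.Relation.Unary.All.Properties as All
open import Data.List.Relation.Binary.Subset.Propositional using () renaming (_⊆_ to _⊆ˡ_)
open import Data.List.Relation.Binary.Subset.Propositional.Properties
  using (⊆-refl; ⊆-trans; xs⊆x∷xs; ∷⁺ʳ; ∈-∷⁺ʳ; xs⊆xs++ys; xs⊆ys++xs; ⊆-reflexive-↭)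
open import Data.List.Relation.Binary.Permutation.Propositional using (swap; ↭-refl)
open import Data.Maybe using (Maybe)
open import Data.Nat using (ℕ; zero; suc; _+_; _⊔_; _≤_; s≤s; _≤′_; ≤′-refl; ≤′-step)
open import Data.Nat.Properties
  using (+-suc; +-identityʳ; suc-injective; ≤-refl; ≤⇒≤′; m≤m⊔n; m≤n⊔m; m⊔n≤o⇒m≤o; m⊔n≤o⇒n≤o)
open import Data.Product using (Σ; ∃-syntax; _×_; _,_; proj₁; proj₂; uncurry)
open import Data.Sum using (_⊎_; inj₁; inj₂; [_,_]′)
import Data.Sum as Sum
open import Data.Unit using (tt)
open import Effect.Monad using (RawMonad)
open import Function using (id; _∘_)
open import Function.Bundles using (mk⇔)
open import Level using (0ℓ)
open import Relation.Nullary using (¬_; yes; no)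
open import Relation.Nullary.Decidable using (¬¬-excluded-middle)
open import Relation.Nullary.Negation using (¬¬-Monad; negated-stable; contradiction)
open import Relation.Binary.PropositionalEquality
  using (_≡_; refl; sym; trans; cong; cong₂; subst; module ≡-Reasoning)

open RawMonad (¬¬-Monad {a = 0ℓ}) using (pure; _>>=_)

module _ {k : K} where

  ⊢-top : ∀ {χ} → χ ⊢⟨ k ⟩ top
  ⊢-top = dt₀ _ ax

  ⇒-antitone : ∀ {a a' b} → a' ⊢⟨ k ⟩ a → a ⇒ b ⊢⟨ k ⟩ a' ⇒ b
  ⇒-antitone a'⊢a = cut (andR (dt₀ _ a'⊢a) ax) impTr

  ⋀L-elim : ∀ {x l} → x ∈ l → ⋀L l ⊢⟨ k ⟩ x
  ⋀L-elim {l = _ ∷ []} (here refl) = ax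
  ⋀L-elim {l = _ ∷ _ ∷ _} (here refl) = andL₁
  ⋀L-elim {l = _ ∷ _ ∷ _} (there x∈l) = cut andL₂ (⋀L-elim x∈l)

  ⋀L-intro : ∀ {χ l} → All (χ ⊢⟨ k ⟩_) l → χ ⊢⟨ k ⟩ ⋀L l
  ⋀L-intro [] = ⊢-top
  ⋀L-intro (d ∷ []) = d
  ⋀L-intro (d ∷ ds@(_ ∷ _)) = andR d (⋀L-intro ds)

  ⋀L-mono : ∀ {l l'} → l ⊆ˡ l' → ⋀L l' ⊢⟨ k ⟩ ⋀L l
  ⋀L-mono l⊆l' = ⋀L-intro (All.tabulate (⋀L-elim ∘ l⊆l'))

  ⋀L-∷ : ∀ {x} l → ⋀L l ∧ᶠ x ⊢⟨ k ⟩ ⋀L (x ∷ l)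
  ⋀L-∷ l = ⋀L-intro (andL₂ ∷ All.tabulate (cut andL₁ ∘ ⋀L-elim {l = l}))

  ⋀L-++-cut : ∀ {δ} l' l → ⋀L l' ⊢⟨ k ⟩ δ → ⋀L (l' ++ l) ⊢⟨ k ⟩ ⋀L (δ ∷ l)
  ⋀L-++-cut l' l d =
    ⋀L-intro (cut (⋀L-mono (xs⊆xs++ys l' l)) d ∷ All.tabulate (⋀L-elim ∘ xs⊆ys++xs l l'))

⋀-closed : ∀ {T : Form → Set} → (∀ {a b} → T a → T b → T (a ∧ᶠ b)) →
           ∀ xs → All T (toList xs) → T (⋀ xs)
⋀-closed _∙_ (_ ∷ []) (t ∷ []) = t
⋀-closed _∙_ (_ ∷ y ∷ ys) (t ∷ ts) = t ∙ ⋀-closed _∙_ (y ∷ ys) ts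

++-⊆ₛ : ∀ {Γ : FSet} G {H} → (∀ x → x ∈ G → Γ x) → (∀ x → x ∈ H → Γ x) →
        ∀ x → x ∈ G ++ H → Γ x
++-⊆ₛ G G⊆Γ H⊆Γ x x∈ = [ G⊆Γ x , H⊆Γ x ]′ (∈-++⁻ G x∈)

module _ {k : K} {Γ : FSet} where

  ⊢ₛ-cut : ∀ {a b} → Γ ⊢ₛ⟨ k ⟩ a → a ⊢⟨ k ⟩ b → Γ ⊢ₛ⟨ k ⟩ b
  ⊢ₛ-cut (G , G⊆Γ , d) e = G , G⊆Γ , cut d e

  ⊢ₛ-⋀L : ∀ {l} → All Γ l → Γ ⊢ₛ⟨ k ⟩ ⋀L l
  ⊢ₛ-⋀L {l} l⊆Γ = l , (λ _ → All.lookup l⊆Γ) , ax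

  ⊢ₛ-∈ : ∀ {a} → Γ a → Γ ⊢ₛ⟨ k ⟩ a
  ⊢ₛ-∈ a∈Γ = ⊢ₛ-⋀L (a∈Γ ∷ [])

  ⊢ₛ-∅ : ∀ {a} → top ⊢⟨ k ⟩ a → Γ ⊢ₛ⟨ k ⟩ a
  ⊢ₛ-∅ d = [] , (λ _ ()) , d

  ⊢ₛ-∧ : ∀ {a b} → Γ ⊢ₛ⟨ k ⟩ a → Γ ⊢ₛ⟨ k ⟩ b → Γ ⊢ₛ⟨ k ⟩ a ∧ᶠ b
  ⊢ₛ-∧ (G , G⊆Γ , d) (H , H⊆Γ , e) =
    G ++ H , ++-⊆ₛ G G⊆Γ H⊆Γ ,
    andR (cut (⋀L-mono (xs⊆xs++ys G H)) d) (cut (⋀L-mono (xs⊆ys++xs H G)) e)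

  ⊢ₛ-⇒-antitone : ∀ {a a' b} → a' ⊢⟨ k ⟩ a → Γ ⊢ₛ⟨ k ⟩ (a ⇒ b) → Γ ⊢ₛ⟨ k ⟩ (a' ⇒ b)
  ⊢ₛ-⇒-antitone a'⊢a d = ⊢ₛ-cut d (⇒-antitone a'⊢a)

uniform : Form → Form × Form → T3
uniform ψ p = proj₁ p , proj₂ p , ψ

triples : Form → List⁺ (Form × Form) → List⁺ T3
triples ψ = map⁺ (uniform ψ)

orImp-triples : ∀ ψ ps → orImp (triples ψ ps) ≡ ⋁→ ps
orImp-triples ψ (p ∷ ps) = cong (λ l → ⋁ ((proj₁ p ⇒ proj₂ p) ∷ l)) (sym (map-∘ ps))

⋀-triples : ∀ {T : Form → Set} → (∀ {a b} → T a → T b → T (a ∧ᶠ b)) →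
            ∀ (f : T3 → Form) ψ ps → All (λ p → T (f (uniform ψ p))) (toList ps) →
            T (⋀ (map⁺ f (triples ψ ps)))
⋀-triples {T} _∙_ f ψ ps@(_ ∷ _) ts =
  ⋀-closed {T = T} _∙_ (map⁺ f (triples ψ ps)) (All.map⁺ {f = f} (All.map⁺ {f = uniform ψ} ts))

module _ {k : K} where

  ∨⊥⊢orImp-triples : ∀ ψ ps → ⋁→ ps ∨ᶠ bot ⊢⟨ k ⟩ orImp (triples ψ ps)
  ∨⊥⊢orImp-triples ψ ps = orL (subst (⋁→ ps ⊢⟨ k ⟩_) (sym (orImp-triples ψ ps)) ax) botL

  ⋀L⊢andPA-triples : ∀ M ps → ⋀L (M ++ toList (map⁺ proj₁ ps)) ⊢⟨ k ⟩ andPA (triples (⋀L M) ps)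
  ⋀L⊢andPA-triples M ps@(_ ∷ _) =
    ⋀-triples {T = ⋀L (M ++ _) ⊢⟨ k ⟩_} andR (λ t → tψ t ∧ᶠ ta t) (⋀L M) ps (All.tabulate λ p∈ →
      andR (⋀L-mono (xs⊆xs++ys M _)) (⋀L-elim (xs⊆ys++xs _ M (∈-map⁺ proj₁ p∈))))

  refl₁-premise : ∀ {ψ χ} ps → All (λ p → ψ ∧ᶠ proj₂ p ⊢⟨ k ⟩ χ) (toList ps) →
                  ∀ t → t ∈ toList (triples ψ ps) → tψ t ∧ᶠ tb t ⊢⟨ k ⟩ χ
  refl₁-premise (_ ∷ _) ds t t∈ = All.lookup (All.map⁺ ds) t∈

module _ {Φ : FSet} where

  antecedents∈ : ∀ ps → (∀ p → p ∈ toList ps → Φ (proj₁ p) × ¬ Φ (proj₂ p)) →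
                 All Φ (toList (map⁺ proj₁ ps))
  antecedents∈ (_ ∷ _) sep = All.map⁺ (All.tabulate (proj₁ ∘ sep _))

  consequents∉ : ∀ ps → (∀ p → p ∈ toList ps → Φ (proj₁ p) × ¬ Φ (proj₂ p)) →
                 All (¬_ ∘ Φ) (toList (map⁺ proj₂ ps))
  consequents∉ (_ ∷ _) sep = All.map⁺ (All.tabulate (proj₂ ∘ sep _))

Wb-intro : ∀ {k Φ} γ → Closed k Φ → ¬ Φ bot → (k ≡ two → Disjoint Φ (Iset k γ Φ)) →
           Wb k Φ (Iset k γ Φ)
Wb-intro {one} γ closed bot∉Φ _ = γ , closed , bot∉Φ , tt , λ _ → mk⇔ id id
Wb-intro {two} γ closed bot∉Φ disjoint = γ , closed , bot∉Φ , disjoint refl , λ _ → mk⇔ id id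

-- Cantor's enumeration of ℕ × ℕ along anti-diagonals.
zigzag : ℕ × ℕ → ℕ × ℕ
zigzag (m , suc n) = suc m , n
zigzag (m , zero)  = zero , suc m

unpair : ℕ → ℕ × ℕ
unpair zero    = zero , zero
unpair (suc i) = zigzag (unpair i)

unpair-onto-diagonal : ∀ s m n → m + n ≡ s → ∃[ i ] unpair i ≡ (m , n)
unpair-onto-diagonal _ zero zero _ = zero , refl
unpair-onto-diagonal s (suc m) n m+n≡s =
  let i , e = unpair-onto-diagonal s m (suc n) (trans (+-suc m n) m+n≡s)
  in suc i , cong zigzag e
unpair-onto-diagonal (suc s) zero (suc n) n≡s =
  let i , e = unpair-onto-diagonal s n zero (trans (+-identityʳ n) (suc-injective n≡s))
  in suc i , cong zigzag e

unpair-surjective : ∀ m n → ∃[ i ] unpair i ≡ (m , n)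
unpair-surjective m n = unpair-onto-diagonal (m + n) m n refl

mutual
  decode : ℕ → ℕ → Form
  decode zero    _ = bot
  decode (suc f) c = node f (unpair c)

  node : ℕ → ℕ × ℕ → Form
  node f (0 , m) = var m
  node f (1 , _) = bot
  node f (2 , m) = branch f _∧ᶠ_ m
  node f (3 , m) = branch f _∨ᶠ_ m
  node f (suc (suc (suc (suc _))) , m) = branch f _⇒_ m

  branch : ℕ → (Form → Form → Form) → ℕ → Form
  branch f op m = op (decode f (proj₁ (unpair m))) (decode f (proj₂ (unpair m)))

-- Any fuel above f works, so the two halves of a compound formula can share one bound.
Decodes : Form → Set
Decodes φ = ∃[ f ] ∃[ c ] ∀ {g} → f ≤ g → decode g c ≡ φ

decodes-leaf : ∀ {φ} t m → (∀ g → node g (t , m) ≡ φ) → Decodes φ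
decodes-leaf t m node≡φ =
  let c , e = unpair-surjective t m
  in 1 , c , λ { {suc g} (s≤s _) → trans (cong (node g) e) (node≡φ g) }

decodes-branch : ∀ t op → (∀ g m → node g (t , m) ≡ branch g op m) →
                 ∀ {φ ψ} → Decodes φ → Decodes ψ → Decodes (op φ ψ)
decodes-branch t op node≡branch {φ} {ψ} (f , c , dφ) (f' , c' , dψ) =
  let m , em = unpair-surjective c c'
      i , ei = unpair-surjective t m
  in suc (f ⊔ f') , i , λ { {suc g} (s≤s f⊔f'≤g) → begin
       node g (unpair i)              ≡⟨ cong (node g) ei ⟩
       node g (t , m)                 ≡⟨ node≡branch g m ⟩
       branch g op m                  ≡⟨ cong (uncurry λ a b → op (decode g a) (decode g b)) em ⟩
       op (decode g c) (decode g c')  ≡⟨ cong₂ op (dφ (m⊔n≤o⇒m≤o f f' f⊔f'≤g))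
                                                  (dψ (m⊔n≤o⇒n≤o f f' f⊔f'≤g)) ⟩
       op φ ψ                         ∎ }
  where open ≡-Reasoning

decodes : ∀ φ → Decodes φ
decodes (var n)  = decodes-leaf 0 n (λ _ → refl)
decodes bot      = decodes-leaf 1 0 (λ _ → refl)
decodes (φ ∧ᶠ ψ) = decodes-branch 2 _∧ᶠ_ (λ _ _ → refl) (decodes φ) (decodes ψ)
decodes (φ ∨ᶠ ψ) = decodes-branch 3 _∨ᶠ_ (λ _ _ → refl) (decodes φ) (decodes ψ)
decodes (φ ⇒ ψ)  = decodes-branch 4 _⇒_ (λ _ _ → refl) (decodes φ) (decodes ψ)

enum : ℕ → Form
enum = uncurry decode ∘ unpair

enum-surjective : ∀ φ → ∃[ i ] enum i ≡ φ
enum-surjective φ =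
  let f , c , d = decodes φ
      i , e = unpair-surjective f c
  in i , trans (cong (uncurry decode) e) (d ≤-refl)

_∪｛_｝ : FSet → Form → FSet
(P ∪｛ x ｝) y = P y ⊎ y ≡ x

All-∪｛｝ : ∀ {P x l} → All (P ∪｛ x ｝) l → ∃[ l' ] All P l' × l ⊆ˡ x ∷ l'
All-∪｛｝ [] = [] , [] , λ ()
All-∪｛｝ (inj₁ p ∷ ps) =
  let l' , ps' , l⊆ = All-∪｛｝ ps
  in _ ∷ l' , p ∷ ps' , ∈-∷⁺ʳ (there (here refl)) (⊆-trans l⊆ (∷⁺ʳ _ (xs⊆x∷xs l' _)))
All-∪｛｝ (inj₂ refl ∷ ps) =
  let l' , ps' , l⊆ = All-∪｛｝ ps
  in l' , ps' , ∈-∷⁺ʳ (here refl) l⊆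

module Lindenbaum {k : K} (Bad : List Form → Set)
  (Bad-mono : ∀ {l l'} → l ⊆ˡ l' → Bad l → Bad l')
  (Bad-cut : ∀ {δ l} l' → ⋀L l' ⊢⟨ k ⟩ δ → Bad (δ ∷ l) → Bad (l' ++ l))
  (Base : FSet) (Base-consistent : ∀ {l} → All Base l → ¬ Bad l) where

  Consistent : FSet → Set
  Consistent P = ∀ {l} → All P l → ¬ Bad l

  stage : ℕ → FSet
  stage zero = Base
  stage (suc n) x = stage n x ⊎ (x ≡ enum n × Consistent (stage n ∪｛ enum n ｝))

  stage-mono : ∀ {m n x} → m ≤′ n → stage m x → stage n x
  stage-mono ≤′-refl x∈ = x∈
  stage-mono (≤′-step m≤n) x∈ = inj₁ (stage-mono m≤n x∈)

  stage-consistent : ∀ n → Consistent (stage n)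
  stage-consistent zero = Base-consistent
  stage-consistent (suc n) ps bad =
    ¬¬-excluded-middle {A = Consistent (stage n ∪｛ enum n ｝)} λ where
      (yes c) → c (All.map (Sum.map₂ proj₁) ps) bad
      (no ¬c) → stage-consistent n (All.map [ id , ⊥-elim ∘ ¬c ∘ proj₂ ]′ ps) bad

  -- The double negation makes Φ ¬¬-stable, which is all the classical logic the argument needs.
  Φ : FSet
  Φ x = ¬ ¬ (∃[ n ] stage n x)

  Φ-stable : ∀ {x} → ¬ ¬ Φ x → Φ x
  Φ-stable = negated-stable

  stage⊆Φ : ∀ n → stage n ⊆ Φ
  stage⊆Φ n _ x∈ = contradiction (n , x∈)

  Base⊆Φ : Base ⊆ Φ
  Base⊆Φ = stage⊆Φ zero

  Φ-finite : ∀ {l} → All Φ l → ¬ ¬ (∃[ n ] All (stage n) l)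
  Φ-finite [] = pure (zero , [])
  Φ-finite (x∈Φ ∷ l⊆Φ) = do
    m , x∈ ← x∈Φ
    n , l⊆ ← Φ-finite l⊆Φ
    pure (m ⊔ n , stage-mono (≤⇒≤′ (m≤m⊔n m n)) x∈ ∷ All.map (stage-mono (≤⇒≤′ (m≤n⊔m m n))) l⊆)

  Φ-consistent : Consistent Φ
  Φ-consistent l⊆Φ bad = Φ-finite l⊆Φ λ (n , l⊆) → stage-consistent n l⊆ bad

  Φ-excludes : ∀ {x} → Bad (x ∷ []) → ¬ Φ x
  Φ-excludes bad x∈Φ = Φ-consistent (x∈Φ ∷ []) bad

  inconsistent : ∀ {P} → ¬ Consistent P → ¬ ¬ (∃[ l ] All P l × Bad l)
  inconsistent ¬c ¬bad = ¬c λ l⊆P bad → ¬bad (_ , l⊆P , bad)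

  Φ-maximal : ∀ {x} → ¬ Φ x → ¬ ¬ (∃[ l ] All Φ l × Bad (x ∷ l))
  Φ-maximal {x} x∉Φ with enum-surjective x
  ... | n , refl = do
    no ¬c ← ¬¬-excluded-middle {A = Consistent (stage n ∪｛ enum n ｝)}
      where yes c → ⊥-elim (x∉Φ (stage⊆Φ (suc n) x (inj₂ (refl , c))))
    l , l⊆ , bad ← inconsistent ¬c
    let l' , l'⊆ , l⊆x∷l' = All-∪｛｝ l⊆
    pure (l' , All.map (stage⊆Φ n _) l'⊆ , Bad-mono l⊆x∷l' bad)

  Φ-maximal-all : ∀ {xs} → All (¬_ ∘ Φ) xs → ¬ ¬ (∃[ M ] All Φ M × All (λ x → Bad (x ∷ M)) xs)
  Φ-maximal-all [] = pure ([] , [] , [])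
  Φ-maximal-all (x∉Φ ∷ xs∉Φ) = do
    l , l⊆Φ , bad ← Φ-maximal x∉Φ
    M , M⊆Φ , bads ← Φ-maximal-all xs∉Φ
    pure (l ++ M , All.++⁺ l⊆Φ M⊆Φ ,
          Bad-mono (∷⁺ʳ _ (xs⊆xs++ys l M)) bad ∷ All.map (Bad-mono (∷⁺ʳ _ (xs⊆ys++xs M l))) bads)

  Φ-closed : Closed k Φ
  Φ-closed δ (l' , l'⊆Φ , d) = Φ-stable λ δ∉Φ → Φ-maximal δ∉Φ λ (l , l⊆Φ , bad) →
    Φ-consistent (All.++⁺ (All.tabulate (l'⊆Φ _)) l⊆Φ) (Bad-cut l' d bad)

  Φ-separation : ∀ ps → (∀ p → p ∈ toList ps → Φ (proj₁ p) × ¬ Φ (proj₂ p)) →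
    ¬ ¬ (∃[ M ] All Φ (M ++ toList (map⁺ proj₁ ps)) × All (λ p → Bad (proj₂ p ∷ M)) (toList ps))
  Φ-separation ps@(_ ∷ _) sep = do
    M , M⊆Φ , bads ← Φ-maximal-all (consequents∉ ps sep)
    pure (M , All.++⁺ M⊆Φ (antecedents∈ ps sep) , All.map⁻ bads)

module Implication {k : K} (Ctx : FSet) (β : Form) (Base : FSet)
  (Base-consistent : ∀ {l} → All Base l → ¬ Ctx ⊢ₛ⟨ k ⟩ (⋀L l ⇒ β)) where

  Refutes : List Form → Set
  Refutes l = Ctx ⊢ₛ⟨ k ⟩ (⋀L l ⇒ β)

  open Lindenbaum Refutes (λ l⊆l' → ⊢ₛ-⇒-antitone (⋀L-mono l⊆l'))
    (λ l' d → ⊢ₛ-⇒-antitone (⋀L-++-cut l' _ d)) Base Base-consistent public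

  triples-refutation : ∀ ps → (∀ p → p ∈ toList ps → Φ (proj₁ p) × ¬ Φ (proj₂ p)) →
    ¬ ¬ (∃[ M ] All Φ M × ∃[ ψ ] Ctx ⊢ₛ⟨ k ⟩ andImp (triples ψ ps) β
                                × ⋀L M ⊢⟨ k ⟩ andPA (triples ψ ps))
  triples-refutation ps sep = do
    M , M⊆Φ , refs ← Φ-separation ps sep
    pure (_ , M⊆Φ , ⋀L M ,
          ⋀-triples {T = Ctx ⊢ₛ⟨ k ⟩_} ⊢ₛ-∧ (λ t → tψ t ∧ᶠ tb t ⇒ β) (⋀L M) ps
            (All.map (⊢ₛ-⇒-antitone (⋀L-∷ M)) refs) ,
          ⋀L⊢andPA-triples M ps)

  Ctx-disjoint : Disjoint Ctx (Iset k bot Φ)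
  Ctx-disjoint φ φ∈Ctx (ps , sep , φ⊢) = triples-refutation ps sep λ (M , M⊆Φ , ψ , imps , ants) →
    let ors = ⊢ₛ-cut (⊢ₛ-∈ φ∈Ctx) (cut φ⊢ (∨⊥⊢orImp-triples ψ ps))
    in Φ-consistent M⊆Φ (⊢ₛ-cut (⊢ₛ-∧ ors imps) (cut (impOrS (triples ψ ps) β) (⇒-antitone ants)))

  Φ-disjoint : k ≡ two → Disjoint Φ (Iset k bot Φ)
  Φ-disjoint k≡two φ φ∈Φ (ps , sep , φ⊢) = triples-refutation ps sep λ (M , M⊆Φ , ψ , imps , ants) →
    let ants∧ors = andR (cut (⋀L-mono (xs⊆x∷xs M φ)) ants)
                        (cut (⋀L-elim {l = φ ∷ M} (here refl)) (cut φ⊢ (∨⊥⊢orImp-triples ψ ps)))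
    in Φ-consistent (φ∈Φ ∷ M⊆Φ)
         (⊢ₛ-cut imps (cut (refl₂ (triples ψ ps) β k≡two) (⇒-antitone ants∧ors)))

  Φ-Wb : Wb k Φ (Iset k bot Φ)
  Φ-Wb = Wb-intro bot Φ-closed (Φ-excludes (⊢ₛ-∅ (dt₀ _ botL))) Φ-disjoint

∨-common-bound : ∀ {k I} → OrClosed I → ∀ {φ φs} → All (λ χ → ∃[ i ] I i × χ ⊢⟨ k ⟩ i) (φ ∷ φs) →
                 ∃[ i ] I i × All (_⊢⟨ k ⟩ i) (φ ∷ φs)
∨-common-bound I-∨ ((i , i∈I , d) ∷ []) = i , i∈I , d ∷ []
∨-common-bound I-∨ ((i , i∈I , d) ∷ bounds@(_ ∷ _)) =
  let j , j∈I , ds = ∨-common-bound I-∨ bounds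
  in i ∨ᶠ j , I-∨ i j i∈I j∈I , cut d orR₁ ∷ All.map (λ e → cut e orR₂) ds

module Extension {k : K} (Γ I : FSet) (i₀ : Σ Form I) (I-∨ : OrClosed I)
  (Γ-avoids-I : ∀ α → Γ ⊢ₛ⟨ k ⟩ α → I α → ⊥) where

  Reaches : List Form → Set
  Reaches l = ∃[ i ] I i × ⋀L l ⊢⟨ k ⟩ i

  reaches-antitone : ∀ {a b} → a ⊢⟨ k ⟩ b → ∃[ i ] I i × b ⊢⟨ k ⟩ i → ∃[ i ] I i × a ⊢⟨ k ⟩ i
  reaches-antitone a⊢b (i , i∈I , d) = i , i∈I , cut a⊢b d

  open Lindenbaum Reaches (λ l⊆l' → reaches-antitone (⋀L-mono l⊆l'))
    (λ l' d → reaches-antitone (⋀L-++-cut l' _ d)) Γ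
    (λ l⊆Γ (i , i∈I , d) → Γ-avoids-I i (⊢ₛ-cut (⊢ₛ-⋀L l⊆Γ) d) i∈I) public

  Φ-disjoint : k ≡ two → Disjoint Φ (Iset k bot Φ)
  Φ-disjoint k≡two φ φ∈Φ (ps@(_ ∷ _) , sep , φ⊢) = Φ-separation ps sep λ (M , M⊆Φ , reaches) →
    let j , j∈I , ds = ∨-common-bound I-∨ (All.map⁺ reaches)
        ψ = ⋀L M
        L = M ++ toList (map⁺ proj₁ ps)
        ants∧ors = andR (cut (⋀L-mono (xs⊆x∷xs L φ)) (⋀L⊢andPA-triples M ps))
                        (cut (⋀L-elim {l = φ ∷ L} (here refl)) (cut φ⊢ (∨⊥⊢orImp-triples ψ ps)))
    in Φ-consistent (φ∈Φ ∷ M⊆Φ) (j , j∈I , cut ants∧ors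
         (refl₁ (triples ψ ps) j k≡two (refl₁-premise ps (All.map (cut (⋀L-∷ M)) (All.map⁻ ds)))))

  Φ-Wb : Wb k Φ (Iset k bot Φ)
  Φ-Wb = Wb-intro bot Φ-closed (Φ-excludes (proj₁ i₀ , proj₂ i₀ , botL)) Φ-disjoint

  Φ-disjoint-I : Disjoint Φ I
  Φ-disjoint-I i i∈Φ i∈I = Φ-excludes (i , i∈I , ax) i∈Φ

⊆-of : ∀ {xs ys : List Form} → All (_∈ ys) xs → xs ⊆ˡ ys
⊆-of = All.lookup

_⊆⁺_ : List⁺ Form → List⁺ Form → Set
xs ⊆⁺ ys = toList xs ⊆ˡ toList ys

⁺++⁺-⊆ : ∀ {xs ys zs} → xs ⊆⁺ zs → ys ⊆⁺ zs → (xs ⁺++⁺ ys) ⊆⁺ zs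
⁺++⁺-⊆ {xs@(_ ∷ _)} {_ ∷ _} xs⊆zs ys⊆zs = [ xs⊆zs , ys⊆zs ]′ ∘ ∈-++⁻ (toList xs)

module _ {m : Maybe Form} {S : IForm → Set} where

  -- Weakening is not primitive: cut the head θ of Θ against the axiom θ ∷ Δ' ⊐ Θ'.
  weaken : ∀ {Δ Θ Δ' Θ'} → Der m S (Δ ⊐ Θ) → Δ ⊆⁺ Δ' → Θ ⊆⁺ Θ' → Der m S (Δ' ⊐ Θ')
  weaken {Δ@(_ ∷ _)} {Θ@(θ ∷ _)} {Δ'@(_ ∷ _)} {Θ'@(_ ∷ _)} D Δ⊆Δ' Θ⊆Θ' =
    iEq (iCut {Δ₁ = Δ} {Θ₁ = Θ} {Δ₂ = Δ'} {Θ₂ = Θ'} {φ = θ}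
           (iEq D ((λ _ → mk⇔ id id) , λ _ → mk⇔ there (∈-∷⁺ʳ (here refl) ⊆-refl)))
           (iA (here refl) (Θ⊆Θ' (here refl))))
        ((λ _ → mk⇔ (⁺++⁺-⊆ {Δ} {Δ'} Δ⊆Δ' id) (xs⊆ys++xs _ (toList Δ))) ,
         (λ _ → mk⇔ (⁺++⁺-⊆ {Θ} {Θ'} Θ⊆Θ' id) (xs⊆ys++xs _ (toList Θ))))

  cut-⊆ : ∀ {Δ₁ Θ₁ Δ₂ Θ₂ Δ Θ} φ → Der m S (Δ₁ ⊐ Θ₁) → Der m S (Δ₂ ⊐ Θ₂) →
          Δ₁ ⊆⁺ Δ → Θ₁ ⊆⁺ (φ ∷⁺ Θ) → Δ₂ ⊆⁺ (φ ∷⁺ Δ) → Θ₂ ⊆⁺ Θ → Der m S (Δ ⊐ Θ)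
  cut-⊆ {Δ = Δ} {Θ} φ D E Δ₁⊆ Θ₁⊆ Δ₂⊆ Θ₂⊆ =
    weaken (iCut {Δ₁ = Δ} {Θ₁ = Θ} {Δ₂ = Δ} {Θ₂ = Θ} {φ = φ} (weaken D Δ₁⊆ Θ₁⊆) (weaken E Δ₂⊆ Θ₂⊆))
           (⁺++⁺-⊆ {Δ} {Δ} id id) (⁺++⁺-⊆ {Θ} {Θ} id id)

  ⊩⋀L : ∀ l → Der m S ((top ∷ l) ⊐ [ ⋀L l ]⁺)
  ⊩⋀L [] = iA (here refl) (here refl)
  ⊩⋀L (a ∷ []) = iA (there (here refl)) (here refl)
  ⊩⋀L (a ∷ l@(_ ∷ _)) =
    cut-⊆ (⋀L l) (⊩⋀L l) (iAndR {φ = a} {ψ = ⋀L l})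
      (∷⁺ʳ top (xs⊆x∷xs l a)) (⊆-of (here refl ∷ []))
      (⊆-of (there (there (here refl)) ∷ here refl ∷ [])) ⊆-refl

  -- φ stays in the succedent because every i-Cut must leave a nonempty remainder there.
  discharge : ∀ {Λ} φ Θ → Der m S (Λ ⊐ (φ ∷ Θ)) → All (λ θ → Der m S ((θ ∷⁺ Λ) ⊐ [ φ ]⁺)) Θ →
              Der m S (Λ ⊐ [ φ ]⁺)
  discharge φ [] D [] = D
  discharge φ (θ ∷ Θ) D (E ∷ Es) = discharge φ Θ D' Es
    where
    D' = cut-⊆ θ D E ⊆-refl (⊆-reflexive-↭ (swap φ θ ↭-refl)) ⊆-refl (⊆-of (here refl ∷ []))

Der-map : ∀ {m S S' F} → (∀ {F} → S F → S' F) → Der m S F → Der m S' F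
Der-map f (hyp s) = hyp (f s)
Der-map f (iEq D e) = iEq (Der-map f D) e
Der-map f (iA x∈Δ x∈Θ) = iA x∈Δ x∈Θ
Der-map f (iCut D E) = iCut (Der-map f D) (Der-map f E)
Der-map f iAndL₁ = iAndL₁
Der-map f iAndL₂ = iAndL₂
Der-map f iAndR = iAndR
Der-map f (γRefl e ps) = γRefl e ps

iSet-⋀L-mono : ∀ {k γ G H} → G ⊆ˡ H → ∀ {F} → iSet γ (⋀L G ⊢⟨ k ⟩_) F → iSet γ (⋀L H ⊢⟨ k ⟩_) F
iSet-⋀L-mono G⊆H (ps , d , e) = ps , cut (⋀L-mono G⊆H) d , e

compactness : ∀ {k γ m Γ F} → Der m (iSet γ (Γ ⊢ₛ⟨ k ⟩_)) F →
              ∃[ G ] (∀ x → x ∈ G → Γ x) × Der m (iSet γ (⋀L G ⊢⟨ k ⟩_)) F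
compactness (hyp (ps , (G , G⊆Γ , d) , e)) = G , G⊆Γ , hyp (ps , d , e)
compactness (iEq D e) = let G , G⊆Γ , D' = compactness D in G , G⊆Γ , iEq D' e
compactness (iA x∈Δ x∈Θ) = [] , (λ _ ()) , iA x∈Δ x∈Θ
compactness (iCut D E) =
  let G , G⊆Γ , D' = compactness D
      H , H⊆Γ , E' = compactness E
  in G ++ H , ++-⊆ₛ G G⊆Γ H⊆Γ ,
     iCut (Der-map (iSet-⋀L-mono (xs⊆xs++ys G H)) D') (Der-map (iSet-⋀L-mono (xs⊆ys++xs H G)) E')
compactness iAndL₁ = [] , (λ _ ()) , iAndL₁
compactness iAndL₂ = [] , (λ _ ()) , iAndL₂
compactness iAndR = [] , (λ _ ()) , iAndR
compactness (γRefl e ps) = [] , (λ _ ()) , γRefl e ps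

module Fixpoint {k : K} (Γ : FSet) (γ : Form) (Γ⊬γ : ¬ Γ ⊢ₛ⟨ k ⟩ γ) where

  Derivable : IForm → Set
  Derivable = Der (mode k γ) (iSet γ (Γ ⊢ₛ⟨ k ⟩_))

  -- With ⊤ in front, Refutes [] is exactly the premise of (Prop).
  Refutes : List Form → Set
  Refutes l = Derivable ((top ∷ l) ⊐ [ bot ]⁺)

  ⊩-entailed : ∀ {δ} l → ⋀L l ⊢⟨ k ⟩ δ → Derivable ((top ∷ l) ⊐ [ δ ]⁺)
  ⊩-entailed {δ} l d =
    cut-⊆ (⋀L l) (⊩⋀L l) (hyp ([ ⋀L l , δ ]⁺ , ⊢ₛ-∅ (cut (dt₀ top d) orR₁) , refl))
      ⊆-refl (⊆-of (here refl ∷ [])) (⊆-of (here refl ∷ [])) ⊆-refl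

  refutes-mono : ∀ {l l'} → l ⊆ˡ l' → Refutes l → Refutes l'
  refutes-mono l⊆l' r = weaken r (∷⁺ʳ top l⊆l') ⊆-refl

  refutes-front : ∀ {θ l L} → l ⊆ˡ L → Refutes (θ ∷ l) → Derivable ((θ ∷ top ∷ L) ⊐ [ bot ]⁺)
  refutes-front {θ} l⊆L r =
    weaken r (⊆-trans (⊆-reflexive-↭ (swap top θ ↭-refl)) (∷⁺ʳ θ (∷⁺ʳ top l⊆L))) ⊆-refl

  refutes-cut : ∀ {δ l} l' → ⋀L l' ⊢⟨ k ⟩ δ → Refutes (δ ∷ l) → Refutes (l' ++ l)
  refutes-cut {δ} {l} l' d r =
    cut-⊆ δ (⊩-entailed l' d) (refutes-front (xs⊆ys++xs l l') r)
      (∷⁺ʳ top (xs⊆xs++ys l' l)) (⊆-of (here refl ∷ [])) ⊆-refl ⊆-refl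

  ∅-consistent : ∀ {l} → All (λ _ → ⊥) l → ¬ Refutes l
  ∅-consistent [] r = let G , G⊆Γ , D = compactness r in Γ⊬γ (G , G⊆Γ , prop D)

  open Lindenbaum Refutes refutes-mono refutes-cut (λ _ → ⊥) ∅-consistent public

  Φ-satisfies : ∀ {Δ Θ} → Derivable (Δ ⊐ Θ) → All Φ (toList Δ) → ¬ All (¬_ ∘ Φ) (toList Θ)
  Φ-satisfies {Δ} {Θ} D Δ⊆Φ Θ∩Φ=∅ = Φ-maximal-all Θ∩Φ=∅ λ (M , M⊆Φ , refs) →
    Φ-consistent (All.++⁺ Δ⊆Φ M⊆Φ)
      (discharge bot (toList Θ) (weaken D (there ∘ xs⊆xs++ys _ M) there)
                 (All.map (refutes-front (xs⊆ys++xs M (toList Δ))) refs))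

  Γ-disjoint : Disjoint Γ (Iset k γ Φ)
  Γ-disjoint φ φ∈Γ (ps , sep , φ⊢) =
    Φ-satisfies (hyp (ps , ⊢ₛ-cut (⊢ₛ-∈ φ∈Γ) φ⊢ , refl)) (antecedents∈ ps sep) (consequents∉ ps sep)

  Φ-disjoint : k ≡ two → Disjoint Φ (Iset k γ Φ)
  Φ-disjoint refl φ φ∈Φ (ps@(_ ∷ _) , sep , φ⊢) =
    Φ-satisfies (γRefl refl ps) (Φ-closed _ (⊢ₛ-cut (⊢ₛ-∈ φ∈Φ) φ⊢) ∷ antecedents∈ ps sep)
      (consequents∉ ps sep)

  Φ-Wb : Wb k Φ (Iset k γ Φ)
  Φ-Wb = Wb-intro γ Φ-closed (Φ-excludes (iA (there (here refl)) (here refl))) Φ-disjoint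

extension-lemma : ∀ k (Γ I : FSet) → Σ Form I → OrClosed I →
    (∀ α → Γ ⊢ₛ⟨ k ⟩ α → I α → ⊥) →
    Σ FSet λ Φ → Wb k Φ (Iset k bot Φ) × Γ ⊆ Φ × Disjoint Φ I
extension-lemma k Γ I i₀ I-∨ Γ-avoids-I = Φ , Φ-Wb , Base⊆Φ , Φ-disjoint-I
  where open Extension {k} Γ I i₀ I-∨ Γ-avoids-I

implication-lemma : ∀ k (Γ : FSet) α β → ¬ (Γ ⊢ₛ⟨ k ⟩ (α ⇒ β)) →
    Σ FSet λ Φ → Wb k Φ (Iset k bot Φ) × Disjoint Γ (Iset k bot Φ) × Φ α × ¬ Φ β
implication-lemma k Γ α β Γ⊬α⇒β =
  Φ , Φ-Wb , Ctx-disjoint , Base⊆Φ α refl , Φ-excludes (⊢ₛ-∅ (dt₀ _ ax))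
  where
  α-consistent : ∀ {l} → All (_≡ α) l → ¬ Γ ⊢ₛ⟨ k ⟩ (⋀L l ⇒ β)
  α-consistent l≡α = Γ⊬α⇒β ∘ ⊢ₛ-⇒-antitone (⋀L-intro (All.map (λ { refl → ax }) l≡α))
  open Implication {k} Γ β (_≡ α) α-consistent

pseudo-reflexivity : ∀ (Γ Δ : FSet) → Wd one Γ Δ → ¬ Γ bot →
    Σ FSet λ Φ → Wb one Φ (Iset one bot Φ) × Γ ⊆ Φ × Disjoint Γ (Iset one bot Φ)
pseudo-reflexivity Γ Δ (Γ-closed , _) bot∉Γ = Φ , Φ-Wb , Base⊆Φ , Ctx-disjoint
  where
  Γ-consistent : ∀ {l} → All Γ l → ¬ Γ ⊢ₛ⟨ one ⟩ neg (⋀L l)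
  Γ-consistent l⊆Γ Γ⊢¬⋀l = bot∉Γ (Γ-closed bot (⊢ₛ-cut (⊢ₛ-∧ (⊢ₛ-⋀L l⊆Γ) Γ⊢¬⋀l) (absurd refl)))
  open Implication {one} Γ bot Γ Γ-consistent

pseudo-symmetry : ∀ k (Γ Δ Γ' Δ' : FSet) → Wd k Γ Δ → Wd k Γ' Δ' → Disjoint Γ Δ' →
    Σ FSet λ Φ → Wb k Φ (Iset k bot Φ) × Γ ⊆ Φ × Disjoint Γ' (Iset k bot Φ)
pseudo-symmetry k Γ Δ Γ' Δ' (Γ-closed , _) (Γ'-closed , _ , neg-Γ'⊆Δ' , _ , Δ'-down , _) Γ∩Δ'=∅ =
  Φ , Φ-Wb , Base⊆Φ , Ctx-disjoint
  where
  Γ-consistent : ∀ {l} → All Γ l → ¬ Γ' ⊢ₛ⟨ k ⟩ neg (⋀L l)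
  Γ-consistent {l} l⊆Γ Γ'⊢¬⋀l =
    Γ∩Δ'=∅ (⋀L l) (Γ-closed _ (⊢ₛ-⋀L l⊆Γ)) (Δ'-down _ _ (neg-Γ'⊆Δ' _ (Γ'-closed _ Γ'⊢¬⋀l)) nnI)
  open Implication {k} Γ' bot Γ Γ-consistent

fixpoint-lemma : ∀ k (Γ : FSet) γ → ¬ (Γ ⊢ₛ⟨ k ⟩ γ) →
    Σ FSet λ Φ → Wb k Φ (Iset k γ Φ) × Disjoint Γ (Iset k γ Φ)
fixpoint-lemma k Γ γ Γ⊬γ = Φ , Φ-Wb , Γ-disjoint
  where open Fixpoint {k} Γ γ Γ⊬γ

lemma16 :
    (∀ k (Γ I : FSet) → Σ Form I → OrClosed I →
        (∀ α → Γ ⊢ₛ⟨ k ⟩ α → I α → ⊥) →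
        Σ FSet λ Φ → Wb k Φ (Iset k bot Φ) × Γ ⊆ Φ × Disjoint Φ I)
    × (∀ k (Γ : FSet) α β → ¬ (Γ ⊢ₛ⟨ k ⟩ (α ⇒ β)) →
        Σ FSet λ Φ → Wb k Φ (Iset k bot Φ) × Disjoint Γ (Iset k bot Φ) × Φ α × ¬ Φ β)
    × (∀ k (Γ : FSet) γ → ¬ (Γ ⊢ₛ⟨ k ⟩ γ) →
        Σ FSet λ Φ → Wb k Φ (Iset k γ Φ) × Disjoint Γ (Iset k γ Φ))
    × (∀ (Γ Δ : FSet) → Wd one Γ Δ → ¬ Γ bot →
        Σ FSet λ Φ → Wb one Φ (Iset one bot Φ) × Γ ⊆ Φ × Disjoint Γ (Iset one bot Φ))
    × (∀ k (Γ Δ Γ' Δ' : FSet) → Wd k Γ Δ → Wd k Γ' Δ' → Disjoint Γ Δ' →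
        Σ FSet λ Φ → Wb k Φ (Iset k bot Φ) × Γ ⊆ Φ × Disjoint Γ' (Iset k bot Φ))
lemma16 =
  extension-lemma , implication-lemma , fixpoint-lemma , pseudo-reflexivity , pseudo-symmetry
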